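{- Let $T$ be a tree which is not a path and satisfies $\dim(T)=Z(T)$, and let $S$ be a minimum zero forcing set of $T$. Let $v$ be any major vertex of $T$ with $ter(v)=k\ge 1$, and for $1\le i\le k$ let $P^i$ be the path from $v$ to the $i$-th terminal vertex $\ell_i$ of $v$. Then $S\cap V(P^i)=\emptyset$ for exactly one $i$. Consequently, if $x\in S$, then $x$ lies on a $v$–$\ell$ path with $x\ne v$, where $\ell$ is a terminal vertex of some major vertex $v$ with $ter(v)\ge 2$.
   Context: $\dim(T)$: metric dimension (minimum size of a set $W$ of vertices such that each vertex is uniquely determined by its vector of distances to $W$). $Z(T)$: zero forcing number (minimum size of an initial black set such that repeatedly turning black the unique white neighbor of any black vertex with exactly one white neighbor eventually blackens all vertices); a minimum zero forcing set is one of size $Z(T)$. A major vertex is a vertex of degree at least $3$. An end-vertex $u$ is a terminal vertex of a major vertex $v$ if $d(u,v)<d(u,w)$ for every other major vertex $w$. $ter(v)$ (terminal degree) is the number of terminal vertices of $v$. -}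

module Defs where

open import Data.Nat using (ℕ; suc; _≤_; _<_)
open import Data.Fin using (Fin; toℕ)
open import Data.Fin.Subset using (Subset; _∈_; _∉_; ∣_∣)
open import Data.Bool using (Bool; true)
open import Data.Vec using (tabulate)
open import Data.List using (List; []; _∷_; length)
open import Data.List.Relation.Unary.Unique.Propositional using (Unique)
open import Data.Product using (Σ; ∃; _×_; _,_)
open import Data.Sum using (_⊎_)
open import Data.Empty using (⊥)
open import Relation.Nullary using (¬_)
open import Relation.Binary.PropositionalEquality using (_≡_; _≢_)
open import Function.Bundles using (_⇔_)
open import Function.Definitions using (Injective)

record Graph (n : ℕ) : Set where
  field
    adj   : Fin n → Fin n → Bool
    sym   : ∀ u v → adj u v ≡ adj v u
    irref : ∀ u → adj u u ≡ true → ⊥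
open Graph public

module _ {n : ℕ} (G : Graph n) where

  Adj : Fin n → Fin n → Set
  Adj u v = adj G u v ≡ true

  nbhd : Fin n → Subset n
  nbhd u = tabulate (adj G u)

  deg : Fin n → ℕ
  deg u = ∣ nbhd u ∣

  -- Walk u t p : p is the vertex list of a walk from u to t
  data Walk : Fin n → Fin n → List (Fin n) → Set where
    w-nil  : ∀ u → Walk u u (u ∷ [])
    w-cons : ∀ {u w t p} → Adj u w → Walk w t p → Walk u t (u ∷ p)

  IsPath : Fin n → Fin n → List (Fin n) → Set
  IsPath u t p = Walk u t p × Unique p

  Connected : Set
  Connected = ∀ u v → ∃ λ p → Walk u v p

  HasCycle : Set
  HasCycle = ∃ λ u → ∃ λ w → ∃ λ p → IsPath u w p × 3 ≤ length p × Adj w u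

  IsTree : Set
  IsTree = Connected × ¬ HasCycle

  IsPathGraph : Set
  IsPathGraph = Σ (Fin n → Fin n) λ f → Injective _≡_ _≡_ f ×
    (∀ i j → Adj (f i) (f j) ⇔ (suc (toℕ i) ≡ toℕ j ⊎ suc (toℕ j) ≡ toℕ i))

  -- Dist u v m : d(u,v) = m (a shortest walk has m edges)
  Dist : Fin n → Fin n → ℕ → Set
  Dist u v m = (∃ λ p → Walk u v p × length p ≡ suc m)
             × (∀ q → Walk u v q → suc m ≤ length q)

  Resolving : Subset n → Set
  Resolving W = ∀ x y → (∀ w → w ∈ W → ∀ a b → Dist x w a → Dist y w b → a ≡ b) → x ≡ y

  IsMetricDim : ℕ → Set
  IsMetricDim m = (∃ λ W → Resolving W × ∣ W ∣ ≡ m) × (∀ W → Resolving W → m ≤ ∣ W ∣)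

  -- zero forcing: Black S v means v is eventually coloured black from S
  data Black (S : Subset n) : Fin n → Set where
    initial : ∀ {v} → v ∈ S → Black S v
    force   : ∀ {u w} → Black S u → Adj u w →
              (∀ z → Adj u z → z ≢ w → Black S z) → Black S w

  ZeroForcing : Subset n → Set
  ZeroForcing S = ∀ v → Black S v

  MinZeroForcing : Subset n → Set
  MinZeroForcing S = ZeroForcing S × (∀ S′ → ZeroForcing S′ → ∣ S ∣ ≤ ∣ S′ ∣)

  IsZeroForcingNumber : ℕ → Set
  IsZeroForcingNumber m = (∃ λ S → ZeroForcing S × ∣ S ∣ ≡ m)
                        × (∀ S → ZeroForcing S → m ≤ ∣ S ∣)

  Major : Fin n → Set
  Major v = 3 ≤ deg v

  EndVertex : Fin n → Set
  EndVertex u = deg u ≡ 1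

  Terminal : Fin n → Fin n → Set
  Terminal u v = Major v × EndVertex u ×
    (∀ w → Major w → w ≢ v → ∀ a b → Dist u v a → Dist u w b → a < b)

  Ter : Fin n → ℕ → Set
  Ter v k = ∃ λ (T : Subset n) → (∀ u → (u ∈ T) ⇔ Terminal u v) × ∣ T ∣ ≡ k

module Submission where

-- For a vertex u and a neighbour b, the branch of u at b consists of the
-- vertices whose geodesic from u starts with the edge ub ('Via').  A leg is a
-- major-free branch at a major vertex; its unique leaf is a terminal vertex of
-- u, and every terminal vertex arises this way.  Two facts drive the proof:
--  * a zero forcing set meets one of any two distinct branches at a vertex,
--    since nothing can be forced into a white branch while another branch is
--    white ('zero-forcing-meets-branch');
--  * if X misses at most one leg at each major vertex, the leaves of the legs
--    met by X resolve T, so dim(T) ≤ |X| ('dim≤').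
-- Hence when dim(T) = Z(T) = |S| no proper subset of S misses at most one leg
-- per major vertex.  Removing a vertex of S lying on no leg, or the vertices of
-- S on one leg at v, would give such a subset; so every vertex of S lies on a
-- leg of a vertex with a second leg, and each major vertex has exactly one leg
-- missing S.

open import Defs
open import Data.Nat using (ℕ; zero; suc; _+_; _≤_; _<_; z≤n; s≤s; _≤?_; _≟_)
open import Data.Nat.Properties
open import Data.Fin using (Fin; toℕ; fromℕ<) renaming (_≟_ to _≟ᶠ_)
open import Data.Fin.Properties using (any?; all?; toℕ-fromℕ<; toℕ-injective; toℕ<n; pigeonhole) renaming (<⇒≢ to <⇒≢ᶠ)
open import Data.Fin.Subset using (Subset; _∈_; _∉_; ∣_∣; _∪_; ⁅_⁆; _-_; inside; outside) renaming (⊥ to ∅)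
open import Data.Fin.Subset.Properties using (_∈?_; p⊆q⇒∣p∣≤∣q∣; p⊂q⇒∣p∣<∣q∣; x∈⁅x⁆; x∈p∪q⁺; drop-there; x∈p⇒∣p-x∣<∣p∣; x∈p∧x≢y⇒x∈p-y; ∣⊥∣≡0; ∣⁅x⁆∣≡1)
open import Data.Bool using (Bool; true)
import Data.Bool.Properties as Bool
open import Data.Vec using (tabulate; []; _∷_)
open import Data.Vec.Properties using (lookup∘tabulate; []=⇒lookup; lookup⇒[]=)
open import Data.List using (List; []; _∷_; length; _++_; allFin)
open import Data.List.Relation.Unary.All using (All; []; _∷_; lookup) renaming (map to all-map)
open import Data.List.Relation.Unary.All.Properties using (++⁺)
open import Data.List.Relation.Unary.Any using (here; there)
open import Data.List.Relation.Unary.AllPairs using ([]; _∷_)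
open import Data.List.Relation.Unary.Unique.Propositional using (Unique)
open import Data.List.Membership.Propositional using () renaming (_∈_ to _∈ₗ_)
open import Data.List.Membership.Propositional.Properties using (∈-allFin)
open import Data.Product using (Σ; ∃; ∃₂; _×_; _,_; proj₁; proj₂)
open import Data.Sum using (_⊎_; inj₁; inj₂)
open import Data.Unit using (⊤; tt)
open import Data.Empty using (⊥; ⊥-elim)
open import Function.Bundles using (_⇔_; mk⇔; Equivalence)
open import Relation.Nullary using (¬_; Dec; yes; no; does)
open import Relation.Nullary.Decidable using (_×-dec_; _⊎-dec_; ¬?; _→-dec_)
open import Relation.Binary using (tri<; tri≈; tri>)
open import Relation.Binary.PropositionalEquality using (_≡_; _≢_; refl; cong; cong₂; trans; subst; subst₂; ≢-sym; module ≡-Reasoning) renaming (sym to ≡-sym)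

module _ (P : ℕ → Set) (P? : ∀ k → Dec (P k)) where

  Least : ℕ → Set
  Least k = P k × (∀ j → P j → k ≤ j)

  private
    search : ∀ N → (∃ Least) ⊎ (∀ j → j < N → ¬ P j)
    search zero = inj₂ (λ j ())
    search (suc N) with search N
    ... | inj₁ w = inj₁ w
    ... | inj₂ none with P? N
    ...   | yes pN = inj₁ (N , pN , λ j pj → ≮⇒≥ (λ j<N → none j j<N pj))
    ...   | no ¬pN = inj₂ below
      where
      below : ∀ j → j < suc N → ¬ P j
      below j j<sN pj with m<1+n⇒m<n∨m≡n j<sN
      ... | inj₁ j<N = none j j<N pj
      ... | inj₂ refl = ¬pN pj

  least : ∀ N → P N → ∃ Least
  least N pN with search (suc N)
  ... | inj₁ w = w
  ... | inj₂ none = ⊥-elim (none N ≤-refl pN)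

module _ {n : ℕ} (P : Fin n → Set) (P? : ∀ z → Dec (P z)) (f : Fin n → ℕ) where

  private
    argmax-list : ∀ (xs : List (Fin n)) b → P b →
                  ∃ λ z → P z × f b ≤ f z × (∀ z′ → z′ ∈ₗ xs → P z′ → f z′ ≤ f z)
    argmax-list [] b pb = b , pb , ≤-refl , λ _ ()
    argmax-list (x ∷ xs) b pb with P? x | f b ≤? f x
    ... | yes px | yes b≤x with argmax-list xs x px
    ...   | z , pz , x≤z , max = z , pz , ≤-trans b≤x x≤z ,
            λ { _ (here refl) _ → x≤z ; z′ (there m) pz′ → max z′ m pz′ }
    argmax-list (x ∷ xs) b pb | yes px | no b≰x with argmax-list xs b pb
    ...   | z , pz , b≤z , max = z , pz , b≤z ,
            λ { _ (here refl) _ → ≤-trans (<⇒≤ (≰⇒> b≰x)) b≤z ; z′ (there m) pz′ → max z′ m pz′ }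
    argmax-list (x ∷ xs) b pb | no ¬px | _ with argmax-list xs b pb
    ...   | z , pz , b≤z , max = z , pz , b≤z ,
            λ { _ (here refl) px → ⊥-elim (¬px px) ; z′ (there m) pz′ → max z′ m pz′ }

  argmax : ∀ b → P b → ∃ λ z → P z × (∀ z′ → P z′ → f z′ ≤ f z)
  argmax b pb with argmax-list (allFin n) b pb
  ... | z , pz , _ , max = z , pz , λ z′ → max z′ (∈-allFin z′)

∈-tabulate⁺ : ∀ {n} (f : Fin n → Bool) {x} → f x ≡ true → x ∈ tabulate f
∈-tabulate⁺ f {x} fx = lookup⇒[]= x (tabulate f) (trans (lookup∘tabulate f x) fx)

∈-tabulate⁻ : ∀ {n} (f : Fin n → Bool) {x} → x ∈ tabulate f → f x ≡ true
∈-tabulate⁻ f {x} m = trans (≡-sym (lookup∘tabulate f x)) ([]=⇒lookup m)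

subsetOf : ∀ {n} {P : Fin n → Set} → (∀ x → Dec (P x)) → Subset n
subsetOf P? = tabulate (λ x → does (P? x))

∈-subsetOf⁺ : ∀ {n} {P : Fin n → Set} (P? : ∀ x → Dec (P x)) {x} → P x → x ∈ subsetOf P?
∈-subsetOf⁺ P? {x} p with P? x in eq
... | yes _ = ∈-tabulate⁺ (λ x → does (P? x)) (cong does eq)
... | no ¬p = ⊥-elim (¬p p)

∈-subsetOf⁻ : ∀ {n} {P : Fin n → Set} (P? : ∀ x → Dec (P x)) {x} → x ∈ subsetOf P? → P x
∈-subsetOf⁻ P? {x} m with P? x in eq
... | yes p = p
... | no _ with trans (≡-sym (cong does eq)) (∈-tabulate⁻ (λ x → does (P? x)) m)
...   | ()

∣∪∣≤ : ∀ {n} (p q : Subset n) → ∣ p ∪ q ∣ ≤ ∣ p ∣ + ∣ q ∣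
∣∪∣≤ [] [] = z≤n
∣∪∣≤ (outside ∷ p) (outside ∷ q) = ∣∪∣≤ p q
∣∪∣≤ (outside ∷ p) (inside ∷ q) = subst (suc ∣ p ∪ q ∣ ≤_) (≡-sym (+-suc ∣ p ∣ ∣ q ∣)) (s≤s (∣∪∣≤ p q))
∣∪∣≤ (inside ∷ p) (outside ∷ q) = s≤s (∣∪∣≤ p q)
∣∪∣≤ (inside ∷ p) (inside ∷ q) = s≤s (≤-trans (∣∪∣≤ p q) (+-monoʳ-≤ ∣ p ∣ (n≤1+n _)))

empty-card : ∀ {n} (A : Subset n) → (∀ x → x ∉ A) → ∣ A ∣ ≤ 0
empty-card {n} A none = ≤-trans (p⊆q⇒∣p∣≤∣q∣ {q = ∅} (λ {x} m → ⊥-elim (none x m))) (≤-reflexive (∣⊥∣≡0 n))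

nonempty : ∀ {n} (A : Subset n) → 1 ≤ ∣ A ∣ → ∃ λ x → x ∈ A
nonempty A 1≤ with any? (_∈? A)
... | yes m = m
... | no none = ⊥-elim (1+n≰n (≤-trans 1≤ (empty-card A (λ x m → none (x , m)))))

∈⇒1≤∣∣ : ∀ {n} {A : Subset n} {x} → x ∈ A → 1 ≤ ∣ A ∣
∈⇒1≤∣∣ m = ≤-trans (s≤s z≤n) (x∈p⇒∣p-x∣<∣p∣ m)

two-in : ∀ {n} (A : Subset n) {x y} → x ∈ A → y ∈ A → x ≢ y → 2 ≤ ∣ A ∣
two-in A mx my x≢y = ≤-trans (s≤s (∈⇒1≤∣∣ (x∈p∧x≢y⇒x∈p-y my (≢-sym x≢y)))) (x∈p⇒∣p-x∣<∣p∣ mx)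

three-in : ∀ {n} (A : Subset n) {x y z} → x ∈ A → y ∈ A → z ∈ A → x ≢ y → x ≢ z → y ≢ z → 3 ≤ ∣ A ∣
three-in A mx my mz x≢y x≢z y≢z =
  ≤-trans (s≤s (two-in (A - _) (x∈p∧x≢y⇒x∈p-y my (≢-sym x≢y))
                               (x∈p∧x≢y⇒x∈p-y mz (≢-sym x≢z)) y≢z))
          (x∈p⇒∣p-x∣<∣p∣ mx)

in-one : ∀ {n} (A : Subset n) {a} → (∀ x → x ∈ A → x ≡ a) → ∣ A ∣ ≤ 1
in-one A {a} only = ≤-trans (p⊆q⇒∣p∣≤∣q∣ into) (≤-reflexive (∣⁅x⁆∣≡1 a))
  where
  into : ∀ {x} → x ∈ A → x ∈ ⁅ a ⁆
  into {x} m rewrite only x m = x∈⁅x⁆ a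

in-two : ∀ {n} (A : Subset n) {a b} → (∀ x → x ∈ A → x ≡ a ⊎ x ≡ b) → ∣ A ∣ ≤ 2
in-two A {a} {b} only =
  ≤-trans (p⊆q⇒∣p∣≤∣q∣ into) (≤-trans (∣∪∣≤ ⁅ a ⁆ ⁅ b ⁆) (≤-reflexive (cong₂ _+_ (∣⁅x⁆∣≡1 a) (∣⁅x⁆∣≡1 b))))
  where
  into : ∀ {x} → x ∈ A → x ∈ ⁅ a ⁆ ∪ ⁅ b ⁆
  into {x} m with only x m
  ... | inj₁ refl = x∈p∪q⁺ (inj₁ (x∈⁅x⁆ x))
  ... | inj₂ refl = x∈p∪q⁺ (inj₂ (x∈⁅x⁆ x))

strictly-smaller : ∀ {n} {A B : Subset n} {x} → (∀ {y} → y ∈ A → y ∈ B) → x ∈ B → x ∉ A → ∣ A ∣ < ∣ B ∣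
strictly-smaller A⊆B x∈B x∉A = p⊂q⇒∣p∣<∣q∣ (A⊆B , _ , x∈B , x∉A)

without : ∀ {n} (S : Subset n) {Y : Fin n → Set} → (∀ z → Dec (Y z)) → Subset n
without S Y? = subsetOf (λ s → (s ∈? S) ×-dec ¬? (Y? s))

∈-without⁺ : ∀ {n} {S : Subset n} {Y : Fin n → Set} (Y? : ∀ z → Dec (Y z)) {z} → z ∈ S → ¬ Y z → z ∈ without S Y?
∈-without⁺ {S = S} Y? z∈S ¬Yz = ∈-subsetOf⁺ (λ s → (s ∈? S) ×-dec ¬? (Y? s)) (z∈S , ¬Yz)

without-smaller : ∀ {n} {S : Subset n} {Y : Fin n → Set} (Y? : ∀ z → Dec (Y z)) {y} → y ∈ S → Y y → ∣ without S Y? ∣ < ∣ S ∣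
without-smaller {S = S} Y? y∈S Yy =
  strictly-smaller (λ m → proj₁ (∈-subsetOf⁻ (λ s → (s ∈? S) ×-dec ¬? (Y? s)) m)) y∈S
                   (λ m → proj₂ (∈-subsetOf⁻ (λ s → (s ∈? S) ×-dec ¬? (Y? s)) m) Yy)

module _ {m n : ℕ} (R : Fin m → Fin n → Set) (R? : ∀ s ℓ → Dec (R s ℓ)) where

  image : Subset m → Subset n
  image X = subsetOf (λ ℓ → any? (λ s → (s ∈? X) ×-dec R? s ℓ))

  ∈-image⁺ : ∀ X {s ℓ} → s ∈ X → R s ℓ → ℓ ∈ image X
  ∈-image⁺ X s∈X r = ∈-subsetOf⁺ (λ ℓ → any? (λ s → (s ∈? X) ×-dec R? s ℓ)) (_ , s∈X , r)

  ∈-image⁻ : ∀ X {ℓ} → ℓ ∈ image X → ∃ λ s → s ∈ X × R s ℓ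
  ∈-image⁻ X = ∈-subsetOf⁻ (λ ℓ → any? (λ s → (s ∈? X) ×-dec R? s ℓ))

image-card : ∀ {m n} (R : Fin m → Fin n → Set) (R? : ∀ s ℓ → Dec (R s ℓ)) →
             (∀ {s ℓ ℓ′} → R s ℓ → R s ℓ′ → ℓ ≡ ℓ′) → ∀ X → ∣ image R R? X ∣ ≤ ∣ X ∣
image-card R R? functional [] = empty-card (image R R? []) (λ ℓ m → noSource (∈-image⁻ R R? [] m))
  where
  noSource : ∀ {ℓ} → ¬ ∃ (λ (s : Fin 0) → s ∈ [] × R s ℓ)
  noSource (() , _)
image-card R R? functional (outside ∷ X) = ≤-trans (p⊆q⇒∣p∣≤∣q∣ shift) (image-card R′ R′? functional X)
  where
  R′ = λ s → R (Fin.suc s)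
  R′? = λ s → R? (Fin.suc s)
  shift : ∀ {ℓ} → ℓ ∈ image R R? (outside ∷ X) → ℓ ∈ image R′ R′? X
  shift m with ∈-image⁻ R R? (outside ∷ X) m
  ... | Fin.zero , () , _
  ... | Fin.suc s , s∈ , r = ∈-image⁺ R′ R′? X (drop-there s∈) r
image-card R R? functional (inside ∷ X) =
  ≤-trans (p⊆q⇒∣p∣≤∣q∣ split)
    (≤-trans (∣∪∣≤ rest fromZero)
      (≤-trans (+-mono-≤ (image-card R′ R′? functional X) fromZero≤1) (≤-reflexive (+-comm ∣ X ∣ 1))))
  where
  R′ = λ s → R (Fin.suc s)
  R′? = λ s → R? (Fin.suc s)
  rest = image R′ R′? X
  fromZero = subsetOf (R? Fin.zero)
  fromZero≤1 : ∣ fromZero ∣ ≤ 1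
  fromZero≤1 with any? (R? Fin.zero)
  ... | yes (ℓ₀ , r₀) = in-one fromZero (λ ℓ m → functional (∈-subsetOf⁻ (R? Fin.zero) m) r₀)
  ... | no none = ≤-trans (empty-card fromZero (λ ℓ m → none (ℓ , ∈-subsetOf⁻ (R? Fin.zero) m))) z≤n
  split : ∀ {ℓ} → ℓ ∈ image R R? (inside ∷ X) → ℓ ∈ rest ∪ fromZero
  split m with ∈-image⁻ R R? (inside ∷ X) m
  ... | Fin.zero , _ , r = x∈p∪q⁺ (inj₂ (∈-subsetOf⁺ (R? Fin.zero) r))
  ... | Fin.suc s , s∈ , r = x∈p∪q⁺ (inj₁ (∈-image⁺ R′ R′? X (drop-there s∈) r))

twice-absorbed : ∀ a L → a + (a + L) ≡ L → a ≡ 0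
twice-absorbed zero L _ = refl
twice-absorbed (suc a) L eq = ⊥-elim (1+n≰n (subst (suc L ≤_) eq (s≤s (≤-trans (m≤n+m L (suc a)) (m≤n+m (suc a + L) a)))))

sum-of-successors : ∀ A B → ¬ (suc A + suc B ≤ A + B)
sum-of-successors A B le = 1+n≰n (≤-trans (s≤s (+-monoʳ-≤ A (n≤1+n B))) le)

walk-snoc : ∀ {n} {G : Graph n} {u t s p} → Walk G u t p → Adj G t s → Walk G u s (p ++ s ∷ [])
walk-snoc (w-nil u) e = w-cons e (w-nil _)
walk-snoc (w-cons e′ w) e = w-cons e′ (walk-snoc w e)

unique-snoc : ∀ {n} {xs : List (Fin n)} {y} → Unique xs → All (_≢ y) xs → Unique (xs ++ y ∷ [])
unique-snoc [] [] = [] ∷ []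
unique-snoc (h ∷ t) (p ∷ ps) = ++⁺ h (p ∷ []) ∷ unique-snoc t ps

walk-length≥2 : ∀ {n} {G : Graph n} {a b p} → a ≢ b → Walk G a b p → 2 ≤ length p
walk-length≥2 a≢b (w-nil _) = ⊥-elim (a≢b refl)
walk-length≥2 a≢b (w-cons _ (w-nil _)) = s≤s (s≤s z≤n)
walk-length≥2 a≢b (w-cons _ (w-cons _ _)) = s≤s (s≤s z≤n)

walk-head : ∀ {n} {G : Graph n} {P : Fin n → Set} {w t p} → Walk G w t p → All P p → P w
walk-head (w-nil _) (pw ∷ _) = pw
walk-head (w-cons _ _) (pw ∷ _) = pw

walk-last : ∀ {n} {G : Graph n} {P : Fin n → Set} {w t p} → Walk G w t p → All P p → P t
walk-last (w-nil _) (pt ∷ _) = pt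
walk-last (w-cons _ w) (_ ∷ ps) = walk-last w ps

module GraphFacts {n : ℕ} (G : Graph n) where

  adj-sym : ∀ {u a} → Adj G u a → Adj G a u
  adj-sym {u} {a} e = trans (Graph.sym G a u) e

  Adj? : ∀ u a → Dec (Adj G u a)
  Adj? u a = adj G u a Bool.≟ true

  adj-≢ : ∀ {u a} → Adj G u a → u ≢ a
  adj-≢ e refl = Graph.irref G _ e

  Reach : ℕ → Fin n → Fin n → Set
  Reach zero u t = u ≡ t
  Reach (suc k) u t = Reach k u t ⊎ ∃ λ a → Adj G u a × Reach k a t

  reach? : ∀ k u t → Dec (Reach k u t)
  reach? zero u t = u ≟ᶠ t
  reach? (suc k) u t = reach? k u t ⊎-dec any? (λ a → Adj? u a ×-dec reach? k a t)

  walk⇒reach : ∀ {u t p} → Walk G u t p → Σ ℕ λ k → suc k ≡ length p × Reach k u t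
  walk⇒reach (w-nil u) = 0 , refl , refl
  walk⇒reach (w-cons e w) with walk⇒reach w
  ... | k , len , r = suc k , cong suc len , inj₂ (_ , e , r)

  reach⇒walk : ∀ k {u t} → Reach k u t → Σ (List (Fin n)) λ p → Walk G u t p × length p ≤ suc k
  reach⇒walk zero {u} refl = u ∷ [] , w-nil u , s≤s z≤n
  reach⇒walk (suc k) (inj₁ r) with reach⇒walk k r
  ... | p , w , len = p , w , ≤-trans len (n≤1+n _)
  reach⇒walk (suc k) {u} (inj₂ (a , e , r)) with reach⇒walk k r
  ... | p , w , len = u ∷ p , w-cons e w , s≤s len

  reach-snoc : ∀ k {t a u} → Reach k t a → Adj G a u → Reach (suc k) t u
  reach-snoc zero {u = u} refl e = inj₂ (u , e , refl)
  reach-snoc (suc k) (inj₁ r) e = inj₁ (reach-snoc k r e)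
  reach-snoc (suc k) (inj₂ (b , e′ , r)) e = inj₂ (b , e′ , reach-snoc k r e)

  reach-sym : ∀ k {u t} → Reach k u t → Reach k t u
  reach-sym zero refl = refl
  reach-sym (suc k) (inj₁ r) = inj₁ (reach-sym k r)
  reach-sym (suc k) (inj₂ (a , e , r)) = reach-snoc k (reach-sym k r) (adj-sym e)

  reach-trans : ∀ j k {u z t} → Reach j u z → Reach k z t → Reach (j + k) u t
  reach-trans zero k refl r′ = r′
  reach-trans (suc j) k (inj₁ r) r′ = inj₁ (reach-trans j k r r′)
  reach-trans (suc j) k (inj₂ (a , e , r)) r′ = inj₂ (a , e , reach-trans j k r r′)

  ∈-nbhd⁺ : ∀ {u a} → Adj G u a → a ∈ nbhd G u
  ∈-nbhd⁺ {u} = ∈-tabulate⁺ (adj G u)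

  ∈-nbhd⁻ : ∀ {u a} → a ∈ nbhd G u → Adj G u a
  ∈-nbhd⁻ {u} = ∈-tabulate⁻ (adj G u)

  Major? : ∀ u → Dec (Major G u)
  Major? u = 3 ≤? deg G u

  major-neighbours : ∀ {u} → Major G u →
    ∃ λ a → ∃ λ b → ∃ λ c → Adj G u a × Adj G u b × Adj G u c × a ≢ b × a ≢ c × b ≢ c
  major-neighbours {u} mu with nonempty (nbhd G u) (≤-trans (s≤s z≤n) mu)
  ... | a , a∈ with any? (λ b → (b ∈? nbhd G u) ×-dec ¬? (b ≟ᶠ a))
  ...   | no noB = ⊥-elim (1+n≰n (≤-trans mu (≤-trans (in-one (nbhd G u) onlyA) (n≤1+n 1))))
    where
    onlyA : ∀ x → x ∈ nbhd G u → x ≡ a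
    onlyA x x∈ with x ≟ᶠ a
    ... | yes x≡a = x≡a
    ... | no x≢a = ⊥-elim (noB (x , x∈ , x≢a))
  ...   | yes (b , b∈ , b≢a) with any? (λ c → (c ∈? nbhd G u) ×-dec (¬? (c ≟ᶠ a) ×-dec ¬? (c ≟ᶠ b)))
  ...     | no noC = ⊥-elim (1+n≰n (≤-trans mu (in-two (nbhd G u) onlyAB)))
    where
    onlyAB : ∀ x → x ∈ nbhd G u → x ≡ a ⊎ x ≡ b
    onlyAB x x∈ with x ≟ᶠ a | x ≟ᶠ b
    ... | yes x≡a | _ = inj₁ x≡a
    ... | no _ | yes x≡b = inj₂ x≡b
    ... | no x≢a | no x≢b = ⊥-elim (noC (x , x∈ , x≢a , x≢b))
  ...     | yes (c , c∈ , c≢a , c≢b) =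
            a , b , c , ∈-nbhd⁻ a∈ , ∈-nbhd⁻ b∈ , ∈-nbhd⁻ c∈ ,
            ≢-sym b≢a , ≢-sym c≢a , ≢-sym c≢b

  non-major-neighbours : ∀ {u a b z} → ¬ Major G u → Adj G u a → Adj G u b → a ≢ b → Adj G u z → z ≡ a ⊎ z ≡ b
  non-major-neighbours {u} {a} {b} {z} ¬mu ea eb a≢b ez with z ≟ᶠ a | z ≟ᶠ b
  ... | yes z≡a | _ = inj₁ z≡a
  ... | no _ | yes z≡b = inj₂ z≡b
  ... | no z≢a | no z≢b = ⊥-elim (¬mu (three-in (nbhd G u) (∈-nbhd⁺ ea) (∈-nbhd⁺ eb) (∈-nbhd⁺ ez)
                                        a≢b (≢-sym z≢a) (≢-sym z≢b)))

  leaf-neighbour : ∀ {u a z} → EndVertex G u → Adj G u a → Adj G u z → z ≡ a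
  leaf-neighbour {u} {a} {z} leaf ea ez with z ≟ᶠ a
  ... | yes z≡a = z≡a
  ... | no z≢a = ⊥-elim (1+n≰n (≤-trans (two-in (nbhd G u) (∈-nbhd⁺ ez) (∈-nbhd⁺ ea) z≢a) (≤-reflexive leaf)))

  leaf-intro : ∀ {u a} → Adj G u a → (∀ z → Adj G u z → z ≡ a) → EndVertex G u
  leaf-intro {u} ea only = ≤-antisym (in-one (nbhd G u) (λ x x∈ → only x (∈-nbhd⁻ x∈))) (∈⇒1≤∣∣ (∈-nbhd⁺ ea))

  leaf-not-major : ∀ {u} → EndVertex G u → ¬ Major G u
  leaf-not-major leaf mu with ≤-trans mu (≤-reflexive leaf)
  ... | s≤s ()

module Distance {n : ℕ} (G : Graph n) (conn : Connected G) where
  open GraphFacts G public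

  abstract
    shortest : ∀ u t → ∃ (Least (λ k → Reach k u t) (λ k → reach? k u t))
    shortest u t with walk⇒reach (proj₂ (conn u t))
    ... | k , _ , r = least (λ j → Reach j u t) (λ j → reach? j u t) k r

  dist : Fin n → Fin n → ℕ
  dist u t = proj₁ (shortest u t)

  dist-reach : ∀ u t → Reach (dist u t) u t
  dist-reach u t = proj₁ (proj₂ (shortest u t))

  dist-least : ∀ {u t} j → Reach j u t → dist u t ≤ j
  dist-least {u} {t} = proj₂ (proj₂ (shortest u t))

  dist-refl : ∀ u → dist u u ≡ 0
  dist-refl u = n≤0⇒n≡0 (dist-least 0 refl)

  dist≡0 : ∀ {u t} → dist u t ≡ 0 → u ≡ t
  dist≡0 {u} {t} eq = subst (λ k → Reach k u t) eq (dist-reach u t)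

  dist-sym : ∀ u t → dist u t ≡ dist t u
  dist-sym u t = ≤-antisym (dist-least _ (reach-sym _ (dist-reach t u))) (dist-least _ (reach-sym _ (dist-reach u t)))

  dist-triangle : ∀ u z t → dist u t ≤ dist u z + dist z t
  dist-triangle u z t = dist-least _ (reach-trans _ _ (dist-reach u z) (dist-reach z t))

  dist-adj : ∀ {u a} t → Adj G u a → dist u t ≤ suc (dist a t)
  dist-adj {u} {a} t e = dist-least (suc (dist a t)) (inj₂ (a , e , dist-reach a t))

  dist-pos : ∀ {u t} → u ≢ t → 1 ≤ dist u t
  dist-pos u≢t = n≢0⇒n>0 (λ eq → u≢t (dist≡0 eq))

  dist-step : ∀ {u t m} → dist u t ≡ suc m → ∃ λ a → Adj G u a × dist a t ≡ m
  dist-step {u} {t} {m} eq with subst (λ k → Reach k u t) eq (dist-reach u t)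
  ... | inj₁ r = ⊥-elim (1+n≰n (subst (_≤ m) eq (dist-least m r)))
  ... | inj₂ (a , e , r) = a , e , ≤-antisym (dist-least m r) (≤-pred (subst (_≤ suc (dist a t)) eq (dist-adj t e)))

  dist-Dist : ∀ u t → Dist G u t (dist u t)
  dist-Dist u t with reach⇒walk (dist u t) (dist-reach u t)
  ... | p , w , len = (p , w , ≤-antisym len (walk-longer p w)) , walk-longer
    where
    walk-longer : ∀ q → Walk G u t q → suc (dist u t) ≤ length q
    walk-longer q wq with walk⇒reach wq
    ... | k , len′ , r = subst (suc (dist u t) ≤_) len′ (s≤s (dist-least k r))

  Dist⇒dist : ∀ {u t a} → Dist G u t a → a ≡ dist u t
  Dist⇒dist {u} {t} ((p , w , len) , shortest-p) with walk⇒reach w | reach⇒walk (dist u t) (dist-reach u t)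
  ... | k , len′ , r | q , wq , lenq =
    ≤-antisym (≤-pred (≤-trans (shortest-p q wq) lenq))
              (subst (dist u t ≤_) (suc-injective (trans len′ len)) (dist-least k r))

module Tree {n : ℕ} (G : Graph n) (conn : Connected G) (acyclic : ¬ HasCycle G) where
  open Distance G conn public

  module _ (x : Fin n) where

    level-≢ : ∀ {m a y} → dist a x ≡ m → suc m ≤ dist y x → a ≢ y
    level-≢ {m} da le refl = 1+n≰n (subst (suc m ≤_) da le)

    -- Two distinct vertices at the same distance m from x are never joined by a
    -- path staying at distance ≥ m from x: descending from both ends towards x
    -- either meets (closing a cycle) or yields a shorter such configuration.
    no-level-path : ∀ m {a b q} → a ≢ b → dist a x ≡ m → dist b x ≡ m → Walk G a b q → Unique q →
                    All (λ y → m ≤ dist y x) q → ⊥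
    no-level-path zero a≢b da db _ _ _ = a≢b (trans (dist≡0 da) (≡-sym (dist≡0 db)))
    no-level-path (suc m) {a} {b} {q} a≢b da db w uq far with dist-step da | dist-step db
    ... | a′ , ea , da′ | b′ , eb , db′ with a′ ≟ᶠ b′
    ...   | yes refl = acyclic (a′ , b , a′ ∷ q , (w-cons (adj-sym ea) w , all-map (level-≢ da′) far ∷ uq) ,
                                s≤s (walk-length≥2 a≢b w) , eb)
    ...   | no a′≢b′ = no-level-path m a′≢b′ da′ db′ (w-cons (adj-sym ea) (walk-snoc w eb))
                         (++⁺ (all-map (level-≢ da′) far) (a′≢b′ ∷ []) ∷ unique-snoc uq (all-map (λ le → ≢-sym (level-≢ db′ le)) far))
                         (≤-reflexive (≡-sym da′) ∷ ++⁺ (all-map (≤-trans (n≤1+n m)) far) (≤-reflexive (≡-sym db′) ∷ []))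

    adjacent-dist : ∀ {u a} → Adj G u a → dist a x ≡ suc (dist u x) ⊎ dist u x ≡ suc (dist a x)
    adjacent-dist {u} {a} e with <-cmp (dist a x) (dist u x)
    ... | tri< a<u _ _ = inj₂ (≤-antisym (dist-adj x e) a<u)
    ... | tri> _ _ u<a = inj₁ (≤-antisym (dist-adj x (adj-sym e)) u<a)
    ... | tri≈ _ level _ = ⊥-elim (no-level-path (dist u x) (adj-≢ e) refl level (w-cons e (w-nil a))
                                   ((adj-≢ e ∷ []) ∷ [] ∷ []) (≤-refl ∷ ≤-reflexive (≡-sym level) ∷ []))

  -- Via u z b: the geodesic from u to z leaves u through its neighbour b;
  -- for fixed u and b these z form the branch of u at b.
  Via : Fin n → Fin n → Fin n → Set
  Via u z b = Adj G u b × suc (dist b z) ≡ dist u z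

  Via? : ∀ u z b → Dec (Via u z b)
  Via? u z b = Adj? u b ×-dec (suc (dist b z) ≟ dist u z)

  Free : Subset n → Fin n → Fin n → Set
  Free W u b = ∀ z → Via u z b → z ∉ W

  Free? : ∀ W u b → Dec (Free W u b)
  Free? W u b = all? (λ z → Via? u z b →-dec ¬? (z ∈? W))

  not-free : ∀ {W u b} → ¬ Free W u b → ∃ λ z → Via u z b × z ∈ W
  not-free {W} {u} {b} ¬free with any? (λ z → Via? u z b ×-dec (z ∈? W))
  ... | yes hit = hit
  ... | no ¬hit = ⊥-elim (¬free (λ z zb z∈W → ¬hit (z , zb , z∈W)))

  via-unique : ∀ {u z b c} → Via u z b → Via u z c → b ≡ c
  via-unique {u} {z} {b} {c} (eb , db) (ec , dc) with b ≟ᶠ c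
  ... | yes b≡c = b≡c
  ... | no b≢c = ⊥-elim (no-level-path z (dist b z) b≢c refl (suc-injective (trans dc (≡-sym db)))
                   (w-cons (adj-sym eb) (w-cons ec (w-nil c)))
                   ((adj-≢ (adj-sym eb) ∷ b≢c ∷ []) ∷ (adj-≢ ec ∷ []) ∷ [] ∷ [])
                   (≤-refl ∷ subst (dist b z ≤_) db (n≤1+n _) ∷ ≤-reflexive (suc-injective (trans db (≡-sym dc))) ∷ []))

  via-≢ : ∀ {u z b} → Via u z b → z ≢ u
  via-≢ {u} (_ , d) refl = 0≢1+n (trans (≡-sym (dist-refl u)) (≡-sym d))

  via-exists : ∀ {u z} → z ≢ u → ∃ λ b → Via u z b
  via-exists {u} {z} z≢u = from (dist u z) refl
    where
    from : ∀ k → dist u z ≡ k → ∃ λ b → Via u z b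
    from zero eq = ⊥-elim (z≢u (≡-sym (dist≡0 eq)))
    from (suc m) eq with dist-step eq
    ... | b , e , db = b , e , trans (cong suc db) (≡-sym eq)

  via-self : ∀ {u b} → Adj G u b → Via u b b
  via-self {u} {b} e = e , trans (cong suc (dist-refl b)) (≡-sym (≤-antisym u→b (dist-pos (adj-≢ e))))
    where
    u→b : dist u b ≤ 1
    u→b = subst (λ k → dist u b ≤ suc k) (dist-refl b) (dist-adj b e)

  via-antisym : ∀ {z v q} → Via z v q → Via q v z → ⊥
  via-antisym (_ , d₁) (_ , d₂) = 1+n≰n (≤-trans (n≤1+n _) (≤-reflexive (trans (cong suc d₂) d₁)))

  dist-across : ∀ k {x y} → dist x y ≡ k → ∀ {a} → Via x y a → ∀ w → ¬ Via x w a → dist y w ≡ dist x w + k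
  dist-across zero eq (_ , d) w _ = ⊥-elim (0≢1+n (trans (≡-sym eq) (≡-sym d)))
  dist-across (suc k) {x} {y} eq {a} (e , d) w w∉a = go (a ≟ᶠ y)
    where
    daw : dist a w ≡ suc (dist x w)
    daw with adjacent-dist w e
    ... | inj₁ p = p
    ... | inj₂ p = ⊥-elim (w∉a (e , ≡-sym p))
    day : dist a y ≡ k
    day = suc-injective (trans d eq)
    go : Dec (a ≡ y) → dist y w ≡ dist x w + suc k
    go (yes refl) = begin
      dist a w              ≡⟨ daw ⟩
      suc (dist x w)        ≡⟨ +-comm 1 (dist x w) ⟩
      dist x w + 1          ≡⟨ cong (λ j → dist x w + suc j) (trans (≡-sym (dist-refl a)) day) ⟩
      dist x w + suc k      ∎
      where open ≡-Reasoning
    go (no a≢y) with via-exists {a} {y} (λ eq′ → a≢y (≡-sym eq′))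
    ... | a′ , ya′ = begin
      dist y w              ≡⟨ dist-across k day ya′ w w∉a′ ⟩
      dist a w + k          ≡⟨ cong (_+ k) daw ⟩
      suc (dist x w) + k    ≡⟨ ≡-sym (+-suc (dist x w) k) ⟩
      dist x w + suc k      ∎
      where
      open ≡-Reasoning
      w∉a′ : ¬ Via a w a′
      w∉a′ wa′ with via-unique wa′ (adj-sym e , ≡-sym daw)
      ... | refl = 1+n≰n (≤-trans (n≤1+n (suc k)) (≤-reflexive (trans (cong suc (≡-sym eq)) (trans (proj₂ ya′) day))))

  via-adj : ∀ {u z b z′} → Via u z b → Adj G z z′ → z′ ≢ u → Via u z′ b
  via-adj {u} {z} {b} {z′} zb e z′≢u with via-exists z′≢u
  ... | c , z′c with c ≟ᶠ b
  ...   | yes refl = z′c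
  ...   | no c≢b = ⊥-elim (1+n≰n (≤-trans two (subst (_≤ 1) across near)))
    where
    across : dist z′ z ≡ dist u z + dist u z′
    across = dist-across (dist u z′) refl z′c z (λ zc → c≢b (via-unique zc zb))
    near : dist z′ z ≤ 1
    near = subst (λ k → dist z′ z ≤ suc k) (dist-refl z) (dist-adj z (adj-sym e))
    two : 2 ≤ dist u z + dist u z′
    two = +-mono-≤ (subst (1 ≤_) (proj₂ zb) (s≤s z≤n)) (subst (1 ≤_) (proj₂ z′c) (s≤s z≤n))

  via-walk : ∀ {u c z t q} → Walk G z t q → Via u z c → All (_≢ u) q → All (λ y → Via u y c) q
  via-walk (w-nil _) zc _ = zc ∷ []
  via-walk (w-cons e w) zc (_ ∷ avoid) = zc ∷ via-walk w (via-adj zc e (walk-head w avoid)) avoid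

  -- A zero forcing set meets one of any two distinct branches of a vertex u:
  -- the first vertex of either branch turned black must be forced from
  -- inside its branch, or from u while the other branch is already black.
  zero-forcing-meets-branch : ∀ {S u b c} → ZeroForcing G S → Adj G u b → Adj G u c → b ≢ c →
    Free S u b → Free S u c → ⊥
  zero-forcing-meets-branch {S} {u} {b} {c} zf eb ec b≢c freeB freeC = never-black (zf b) (inj₁ (via-self eb))
    where
    never-black : ∀ {z} → Black G S z → Via u z b ⊎ Via u z c → ⊥
    never-black (initial z∈S) (inj₁ zb) = freeB _ zb z∈S
    never-black (initial z∈S) (inj₂ zc) = freeC _ zc z∈S
    never-black (force {u₀} black e others) (inj₁ zb) with u₀ ≟ᶠ u
    ... | yes refl = never-black (others c ec (λ c≡z → b≢c (via-unique (subst (λ k → Via u k b) (≡-sym c≡z) zb) (via-self ec))))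
                                 (inj₂ (via-self ec))
    ... | no u₀≢u = never-black black (inj₁ (via-adj zb (adj-sym e) u₀≢u))
    never-black (force {u₀} black e others) (inj₂ zc) with u₀ ≟ᶠ u
    ... | yes refl = never-black (others b eb (λ b≡z → b≢c (≡-sym (via-unique (subst (λ k → Via u k c) (≡-sym b≡z) zc) (via-self eb)))))
                                 (inj₁ (via-self eb))
    ... | no u₀≢u = never-black black (inj₂ (via-adj zc (adj-sym e) u₀≢u))

  MajorFree : Fin n → Fin n → Set
  MajorFree u b = ∀ z → Via u z b → ¬ Major G z

  MajorFree? : ∀ u b → Dec (MajorFree u b)
  MajorFree? u b = all? (λ z → Via? u z b →-dec ¬? (Major? z))

  -- Every branch contains a leaf: take a vertex of the branch farthest from u.
  branch-leaf : ∀ {u b} → Adj G u b → ∃ λ ℓ → Via u ℓ b × EndVertex G ℓ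
  branch-leaf {u} {b} e with argmax (λ z → Via u z b) (λ z → Via? u z b) (λ z → dist z u) b (via-self e)
  ... | ℓ , ℓb , farthest with via-exists {ℓ} {u} (λ eq → via-≢ ℓb (≡-sym eq))
  ...   | q , ℓq = ℓ , ℓb , leaf-intro (proj₁ ℓq) only-q
    where
    only-q : ∀ z → Adj G ℓ z → z ≡ q
    only-q z e′ with adjacent-dist u e′
    ... | inj₂ closer = via-unique (e′ , ≡-sym closer) ℓq
    ... | inj₁ farther = ⊥-elim (1+n≰n (≤-trans (≤-reflexive (≡-sym farther)) (farthest z (via-adj ℓb e′ z≢u))))
      where
      z≢u : z ≢ u
      z≢u refl = 0≢1+n (trans (≡-sym (dist-refl u)) farther)

  Between : Fin n → Fin n → Fin n → Set
  Between v ℓ t = dist v t + dist t ℓ ≡ dist v ℓ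

  between-via : ∀ {v ℓ b t} → Via v ℓ b → Between v ℓ t → t ≢ v → Via v t b
  between-via {v} {ℓ} {b} {t} ℓb between t≢v with Via? v t b
  ... | yes tb = tb
  ... | no t∉b = ⊥-elim (t≢v (≡-sym (dist≡0 (twice-absorbed (dist v t) (dist v ℓ) eq))))
    where
    eq : dist v t + (dist v t + dist v ℓ) ≡ dist v ℓ
    eq = trans (cong (dist v t +_) (trans (≡-sym (dist-across (dist v ℓ) refl ℓb t t∉b)) (dist-sym ℓ t))) between

  between-forks : ∀ {v ℓ q r} → Between v ℓ q → Via q v r → Via q ℓ r → ⊥
  between-forks {v} {ℓ} {q} {r} between (_ , rv) (_ , rℓ) = sum-of-successors (dist r v) (dist r ℓ)
    (≤-trans (≤-reflexive (trans (cong₂ _+_ (trans rv (dist-sym q v)) rℓ) between))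
      (≤-trans (dist-triangle v r ℓ) (≤-reflexive (cong (_+ dist r ℓ) (dist-sym v r)))))

  between-step : ∀ {v ℓ q s} → Between v ℓ q → Via q ℓ s → Between v ℓ s
  between-step {v} {ℓ} {q} {s} between (e , sℓ) = ≤-antisym shorter (dist-triangle v s ℓ)
    where
    vs : dist v s ≤ suc (dist v q)
    vs = subst₂ (λ a b → a ≤ suc b) (dist-sym s v) (dist-sym q v) (dist-adj v (adj-sym e))
    shorter : dist v s + dist s ℓ ≤ dist v ℓ
    shorter = ≤-trans (+-monoˡ-≤ (dist s ℓ) vs)
                      (≤-reflexive (trans (≡-sym (+-suc (dist v q) (dist s ℓ))) (trans (cong (dist v q +_) sℓ) between)))

  leg-geodesic : ∀ {v ℓ b} → EndVertex G ℓ → Via v ℓ b → (∀ t → Between v ℓ t → t ≢ v → ¬ Major G t) →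
                 ∀ k z → dist z v ≡ k → Via v z b → Between v ℓ z
  leg-geodesic leaf ℓb ¬major zero z eq zb = ⊥-elim (via-≢ zb (dist≡0 eq))
  leg-geodesic {v} {ℓ} {b} leaf ℓb ¬major (suc k) z eq zb with via-exists {z} {v} (λ e → via-≢ zb (≡-sym e))
  ... | q , (ezq , qv) with q ≟ᶠ v
  -- z is a neighbour of v, hence z = b, the first vertex after v on the geodesic
  ...   | yes refl = subst (Between v ℓ) (≡-sym (via-unique (via-self (adj-sym ezq)) zb)) b-between
    where
    b-between : Between v ℓ b
    b-between = trans (cong (_+ dist b ℓ) (trans (≡-sym (proj₂ (via-self (proj₁ ℓb)))) (cong suc (dist-refl b))))
                      (proj₂ ℓb)
  -- otherwise the predecessor q of z is between v and ℓ by induction, is not a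
  -- leaf (it has the neighbour z farther from v) and not major, so z is its
  -- step towards ℓ
  ...   | no q≢v with via-exists {q} {v} (≢-sym q≢v)
  ...     | r , qr with q ≟ᶠ ℓ
  ...       | yes refl = ⊥-elim (via-antisym (ezq , qv) (subst (Via q v) (≡-sym (leaf-neighbour leaf (proj₁ qr) (adj-sym ezq))) qr))
  ...       | no q≢ℓ with via-exists {q} {ℓ} (≢-sym q≢ℓ)
  ...         | s , qs with non-major-neighbours (¬major q q-between q≢v) (proj₁ qr) (proj₁ qs)
                              (λ r≡s → between-forks q-between qr (subst (Via q ℓ) (≡-sym r≡s) qs)) (adj-sym ezq)
    where
    q-between : Between v ℓ q
    q-between = leg-geodesic leaf ℓb ¬major k q (suc-injective (trans qv eq)) (via-adj zb ezq q≢v)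
  ...           | inj₁ refl = ⊥-elim (via-antisym (ezq , qv) qr)
  ...           | inj₂ refl = between-step (leg-geodesic leaf ℓb ¬major k q (suc-injective (trans qv eq)) (via-adj zb ezq q≢v)) qs

  major-free-between : ∀ {v ℓ b} → MajorFree v b → Via v ℓ b → ∀ t → Between v ℓ t → t ≢ v → ¬ Major G t
  major-free-between free ℓb t between t≢v = free t (between-via ℓb between t≢v)

  -- The leaf of a major-free branch at a major vertex v is a terminal vertex of v:
  -- every other major vertex is reached from it through v.
  leg-leaf-terminal : ∀ {v b ℓ} → Major G v → MajorFree v b → Via v ℓ b → EndVertex G ℓ → Terminal G ℓ v
  leg-leaf-terminal {v} {b} {ℓ} mv free ℓb leaf =
    mv , leaf , λ w mw w≢v a c Da Dc → subst₂ _<_ (≡-sym (Dist⇒dist Da)) (≡-sym (Dist⇒dist Dc)) (closer w mw w≢v)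
    where
    closer : ∀ w → Major G w → w ≢ v → dist ℓ v < dist ℓ w
    closer w mw w≢v = subst₂ _<_ (dist-sym v ℓ) (≡-sym through-v) (+-monoˡ-≤ (dist v ℓ) (dist-pos (≢-sym w≢v)))
      where
      through-v : dist ℓ w ≡ dist v w + dist v ℓ
      through-v = dist-across (dist v ℓ) refl ℓb w (λ wb → free w wb mw)

  terminal-leg : ∀ {ℓ v b} → Terminal G ℓ v → Via v ℓ b → MajorFree v b
  terminal-leg {ℓ} {v} {b} (mv , leaf , nearest) ℓb z zb =
    ¬major z (leg-geodesic leaf ℓb ¬major (dist z v) z refl zb) (via-≢ zb)
    where
    ¬major : ∀ t → Between v ℓ t → t ≢ v → ¬ Major G t
    ¬major t between t≢v mt = 1+n≰n (≤-trans (nearest t mt t≢v _ _ (dist-Dist ℓ v) (dist-Dist ℓ t)) (≤-trans (n≤1+n _) le))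
      where
      le : suc (dist ℓ t) ≤ dist ℓ v
      le = subst₂ (λ a b → suc a ≤ b) (dist-sym t ℓ) (dist-sym v ℓ)
                  (≤-trans (+-monoˡ-≤ (dist t ℓ) (dist-pos (≢-sym t≢v))) (≤-reflexive between))

  leg-leaf-unique : ∀ {v b ℓ ℓ′} → MajorFree v b → Via v ℓ b → EndVertex G ℓ → Via v ℓ′ b → EndVertex G ℓ′ → ℓ′ ≡ ℓ
  leg-leaf-unique {v} {b} {ℓ} {ℓ′} free ℓb leaf ℓ′b leaf′ with ℓ′ ≟ᶠ ℓ
  ... | yes ℓ′≡ℓ = ℓ′≡ℓ
  ... | no ℓ′≢ℓ with via-exists {ℓ′} {v} (λ e → via-≢ ℓ′b (≡-sym e)) | via-exists {ℓ′} {ℓ} (≢-sym ℓ′≢ℓ)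
  ...   | r , ℓ′r | s , ℓ′s = ⊥-elim (between-forks ℓ′-between ℓ′r (subst (Via ℓ′ ℓ) (≡-sym (leaf-neighbour leaf′ (proj₁ ℓ′s) (proj₁ ℓ′r))) ℓ′s))
    where
    ℓ′-between : Between v ℓ ℓ′
    ℓ′-between = leg-geodesic leaf ℓb (major-free-between free ℓb) (dist ℓ′ v) ℓ′ refl ℓ′b

  geodesic : ∀ {ℓ} k u → dist u ℓ ≡ k →
             Σ (List (Fin n)) λ p → IsPath G u ℓ p × All (λ t → dist t ℓ ≤ k) p × (∀ t → Between u ℓ t → t ∈ₗ p)
  geodesic {ℓ} zero u eq with dist≡0 eq
  ... | refl = u ∷ [] , (w-nil u , [] ∷ []) , (≤-reflexive (dist-refl u) ∷ []) , only-u
    where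
    only-u : ∀ t → Between u u t → t ∈ₗ u ∷ []
    only-u t between = here (dist≡0 (m+n≡0⇒n≡0 (dist u t) (trans between (dist-refl u))))
  geodesic {ℓ} (suc k) u eq with dist-step eq
  ... | a , e , da with geodesic {ℓ} k a da
  ...   | p , (w , uq) , near , covers =
          u ∷ p , (w-cons e w , all-map u∉ near ∷ uq) , (≤-reflexive eq ∷ all-map (λ le → ≤-trans le (n≤1+n k)) near) , covers′
    where
    u∉ : ∀ {t} → dist t ℓ ≤ k → u ≢ t
    u∉ le refl = 1+n≰n (subst (_≤ k) eq le)
    covers′ : ∀ t → Between u ℓ t → t ∈ₗ u ∷ p
    covers′ t between with t ≟ᶠ u
    ... | yes refl = here refl
    ... | no t≢u = there (covers t (suc-injective (trans (cong (_+ dist t ℓ) (proj₂ ta)) (trans between (trans eq (cong suc (≡-sym da)))))))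
      where
      ta : Via u t a
      ta = between-via (e , trans (cong suc da) (≡-sym eq)) between t≢u

  -- A path from v to a vertex of the branch at b runs inside that branch, so
  -- it avoids S when v and the branch do.
  path-avoids : ∀ {S : Subset n} {v ℓ b} → Via v ℓ b → Free S v b → v ∉ S →
                ∀ p → IsPath G v ℓ p → All (_∉ S) p
  path-avoids ℓb free v∉S _ (w-nil _ , _) = ⊥-elim (via-≢ ℓb refl)
  path-avoids {S} {v} ℓb free v∉S _ (w-cons e w , v∉rest ∷ _) = v∉S ∷ all-map (λ zc → free _ (subst (Via v _) c≡b zc)) in-branch
    where
    in-branch = via-walk w (via-self e) (all-map (λ v≢z z≡v → v≢z (≡-sym z≡v)) v∉rest)
    c≡b = via-unique (walk-last w in-branch) ℓb

  leg-path : ∀ {v c ℓ} → MajorFree v c → Via v ℓ c → EndVertex G ℓ →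
             ∃ λ p → IsPath G v ℓ p × (∀ z → Via v z c → z ∈ₗ p)
  leg-path {v} {c} {ℓ} free ℓc leaf with geodesic {ℓ} (dist v ℓ) v refl
  ... | p , path , _ , covers =
        p , path , λ z zc → covers z (leg-geodesic leaf ℓc (major-free-between free ℓc) (dist z v) z refl zc)

  HasMajor : Set
  HasMajor = ∃ λ u → Major G u

  OneFreeBranch : Subset n → Set
  OneFreeBranch W = ∀ u b c → Major G u → Adj G u b → Adj G u c → b ≢ c → Free W u b → Free W u c → ⊥

  equidistant-via : ∀ {x y a w} → x ≢ y → Via x y a → dist x w ≡ dist y w → Via x w a
  equidistant-via {x} {y} {a} {w} x≢y ya same with Via? x w a
  ... | yes wa = wa
  ... | no w∉a = ⊥-elim (x≢y (dist≡0 (+-cancelˡ-≡ (dist x w) (dist x y) 0 (begin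
      dist x w + dist x y   ≡⟨ dist-across (dist x y) refl ya w w∉a ⟨
      dist y w              ≡⟨ same ⟨
      dist x w              ≡⟨ +-identityʳ (dist x w) ⟨
      dist x w + 0          ∎))))
    where open ≡-Reasoning

  module _ {W : Subset n} (one-free : OneFreeBranch W) (major : HasMajor) where

    free-unless : ∀ {m u x} → (∀ w → w ∈ W → w ≡ m) → ¬ Via u m x → Free W u x
    free-unless within m∉x z zx z∈W rewrite within z z∈W = m∉x zx

    -- W has two vertices: a major vertex has three branches, and one vertex m
    -- lies in at most one of them.
    not-within-point : ∀ m → ¬ (∀ w → w ∈ W → w ≡ m)
    not-within-point m within = at-major (proj₁ major) (proj₂ major)
      where
      at-major : ∀ u → Major G u → ⊥
      at-major u mu with major-neighbours mu
      ... | a , b , c , ea , eb , ec , a≢b , a≢c , b≢c with Via? u m a | Via? u m b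
      ...     | yes ma | _ = one-free u b c mu eb ec b≢c (free-unless within (λ mb → a≢b (via-unique ma mb)))
                                                         (free-unless within (λ mc → a≢c (via-unique ma mc)))
      ...     | no m∉a | yes mb = one-free u a c mu ea ec a≢c (free-unless within m∉a) (free-unless within (λ mc → b≢c (via-unique mb mc)))
      ...     | no m∉a | no m∉b = one-free u a b mu ea eb a≢b (free-unless within m∉a) (free-unless within m∉b)

    -- Adjacent x, y: W would lie in the branch of x at y and of y at x, so W = ∅.
    adjacent-twins : ∀ {x y} → (∀ w → w ∈ W → Via x w y) → (∀ w → w ∈ W → Via y w x) → ⊥
    adjacent-twins {x} towards-y towards-x = not-within-point x (λ w w∈W → ⊥-elim (via-antisym (towards-y w w∈W) (towards-x w w∈W)))

    -- x, y with a common neighbour a: W lies in the branch of x at a and of y at a.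
    -- If a is major its branches at x and y miss W, otherwise W ⊆ {a}.
    common-neighbour-twins : ∀ {x y a} → Adj G a x → Adj G a y → x ≢ y →
      (∀ w → w ∈ W → Via x w a) → (∀ w → w ∈ W → Via y w a) → ⊥
    common-neighbour-twins {x} {y} {a} ax ay x≢y towards-a towards-a′ with Major? a
    ... | yes ma = one-free a x y ma ax ay x≢y (λ z zx z∈W → via-antisym (towards-a z z∈W) zx)
                                               (λ z zy z∈W → via-antisym (towards-a′ z z∈W) zy)
    ... | no ¬ma = not-within-point a at-a
      where
      at-a : ∀ w → w ∈ W → w ≡ a
      at-a w w∈W with w ≟ᶠ a
      ... | yes w≡a = w≡a
      ... | no w≢a with via-exists w≢a
      ...   | d , wd with non-major-neighbours ¬ma ax ay x≢y (proj₁ wd)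
      ...     | inj₁ refl = ⊥-elim (via-antisym (towards-a w w∈W) wd)
      ...     | inj₂ refl = ⊥-elim (via-antisym (towards-a′ w w∈W) wd)

    Undistinguished : Fin n → Fin n → Set
    Undistinguished x y = ∀ w → w ∈ W → dist x w ≡ dist y w

    towards : ∀ {x y a} → x ≢ y → Via x y a → Undistinguished x y → ∀ w → w ∈ W → Via x w a
    towards x≢y ya same w w∈W = equidistant-via x≢y ya (same w w∈W)

    towards′ : ∀ {x y c} → x ≢ y → Via y x c → Undistinguished x y → ∀ w → w ∈ W → Via y w c
    towards′ x≢y xc same w w∈W = equidistant-via (≢-sym x≢y) xc (≡-sym (same w w∈W))

    -- Distinct x, y are distinguished by W: otherwise replace them by their
    -- neighbours a, c towards each other (also undistinguished, closer by 2)
    -- until they are adjacent or share a neighbour.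
    no-twins : ∀ N x y → dist x y ≤ N → x ≢ y → Undistinguished x y → ⊥
    no-twins zero x y le x≢y _ = x≢y (dist≡0 (n≤0⇒n≡0 le))
    no-twins (suc N) x y le x≢y same with via-exists {x} {y} (≢-sym x≢y) | via-exists {y} {x} x≢y
    ... | a , ya | c , xc with a ≟ᶠ y
    ...   | yes refl = adjacent-twins (towards x≢y ya same) (λ w w∈W → subst (Via a w) c≡x (towards′ x≢y xc same w w∈W))
      where
      c≡x : c ≡ x
      c≡x = via-unique xc (via-self (adj-sym (proj₁ ya)))
    ...   | no a≢y with a ≟ᶠ c
    ...     | yes refl = common-neighbour-twins (adj-sym (proj₁ ya)) (adj-sym (proj₁ xc)) x≢y
                           (towards x≢y ya same) (towards′ x≢y xc same)
    ...     | no a≢c = no-twins N a c closer a≢c same′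
      where
      same′ : Undistinguished a c
      same′ w w∈W = suc-injective (trans (proj₂ (towards x≢y ya same w w∈W))
                                  (trans (same w w∈W) (≡-sym (proj₂ (towards′ x≢y xc same w w∈W)))))
      -- a lies on the geodesic from y to x, hence in the branch of y at c
      a-from-y : Via y a c
      a-from-y with Via? y a c
      ... | yes ac = ac
      ... | no a∉c = ⊥-elim (1+n≰n (≤-trans (+-mono-≤ (dist-pos (≢-sym a≢y)) (dist-pos (≢-sym x≢y)))
                       (subst (_≤ 1) (dist-across (dist y x) refl xc a a∉c)
                         (subst (λ k → dist x a ≤ suc k) (dist-refl a) (dist-adj a (proj₁ ya))))))
      closer : dist a c ≤ N
      closer = subst (_≤ N) (dist-sym c a) (≤-trans (n≤1+n _) (≤-pred (≤-trans (≤-reflexive two-less) le)))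
        where
        two-less : suc (suc (dist c a)) ≡ dist x y
        two-less = trans (cong suc (trans (proj₂ a-from-y) (dist-sym y a))) (proj₂ ya)

    resolving : Resolving G W
    resolving x y same-dists with x ≟ᶠ y
    ... | yes x≡y = x≡y
    ... | no x≢y = ⊥-elim (no-twins (dist x y) x y ≤-refl x≢y
                     (λ w w∈W → same-dists w w∈W _ _ (dist-Dist x w) (dist-Dist y w)))

  leg-free-if-path-avoids : ∀ {S v c ℓ} → MajorFree v c → Via v ℓ c → EndVertex G ℓ →
                            (∀ p → IsPath G v ℓ p → All (_∉ S) p) → Free S v c
  leg-free-if-path-avoids free ℓc leaf avoids z zc z∈S with leg-path free ℓc leaf
  ... | p , path , covers = lookup (avoids p path) (covers z zc) z∈S

  Leg : Fin n → Fin n → Set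
  Leg v b = Major G v × Adj G v b × MajorFree v b

  Leg? : ∀ v b → Dec (Leg v b)
  Leg? v b = Major? v ×-dec Adj? v b ×-dec MajorFree? v b

  OneFreeLeg : Subset n → Set
  OneFreeLeg X = ∀ w c₁ c₂ → Leg w c₁ → Leg w c₂ → c₁ ≢ c₂ → Free X w c₁ → Free X w c₂ → ⊥

  -- A vertex lies on legs of at most one major vertex: seen from the owner of
  -- either leg, the other owner is reached through the leg's root.
  leg-owner-unique : ∀ {v b v′ b′ s} → Leg v b → Via v s b → Leg v′ b′ → Via v′ s b′ → v ≡ v′
  leg-owner-unique {v} {b} {v′} {b′} {s} (mv , _ , free) sb (mv′ , _ , free′) sb′ with v ≟ᶠ v′
  ... | yes v≡v′ = v≡v′
  ... | no v≢v′ = ⊥-elim (v≢v′ (dist≡0 (twice-absorbed (dist v v′) (dist v s) (begin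
      dist v v′ + (dist v v′ + dist v s)   ≡⟨ cong (dist v v′ +_) (trans (≡-sym s→v′) (dist-sym s v′)) ⟩
      dist v v′ + dist v′ s                ≡⟨ cong (_+ dist v′ s) (dist-sym v v′) ⟩
      dist v′ v + dist v′ s                ≡⟨ ≡-sym s→v ⟩
      dist s v                             ≡⟨ dist-sym s v ⟩
      dist v s                             ∎))))
    where
    open ≡-Reasoning
    s→v′ : dist s v′ ≡ dist v v′ + dist v s
    s→v′ = dist-across (dist v s) refl sb v′ (λ v′b → free v′ v′b mv′)
    s→v : dist s v ≡ dist v′ v + dist v′ s
    s→v = dist-across (dist v′ s) refl sb′ v (λ vb′ → free′ v vb′ mv)

  LegLeaf : Fin n → Fin n → Set
  LegLeaf s ℓ = EndVertex G ℓ × ∃₂ λ v b → Leg v b × Via v s b × Via v ℓ b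

  LegLeaf? : ∀ s ℓ → Dec (LegLeaf s ℓ)
  LegLeaf? s ℓ = (deg G ℓ ≟ 1) ×-dec any? (λ v → any? (λ b → Leg? v b ×-dec Via? v s b ×-dec Via? v ℓ b))

  legLeaf-functional : ∀ {s ℓ ℓ′} → LegLeaf s ℓ → LegLeaf s ℓ′ → ℓ ≡ ℓ′
  legLeaf-functional (leaf , v , b , leg , sb , ℓb) (leaf′ , v′ , b′ , leg′ , sb′ , ℓ′b′)
    with leg-owner-unique leg sb leg′ sb′
  ... | refl with via-unique sb sb′
  ...   | refl = ≡-sym (leg-leaf-unique (proj₂ (proj₂ leg)) ℓb leaf ℓ′b′ leaf′)

  legLeaves : Subset n → Subset n
  legLeaves = image LegLeaf LegLeaf?

  leg-leaf-marked : ∀ {X w c} → Leg w c → ¬ Free X w c → ∃ λ ℓ → Via w ℓ c × ℓ ∈ legLeaves X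
  leg-leaf-marked {X} leg@(_ , ec , _) ¬free with not-free ¬free | branch-leaf ec
  ... | s , sc , s∈X | ℓ , ℓc , leaf = ℓ , ℓc , ∈-image⁺ LegLeaf LegLeaf? X s∈X (leaf , _ , _ , leg , sc , ℓc)

  beyond : ∀ {u x w p ch z′} → Via u w x → Via w u p → Via w z′ ch → ch ≢ p → Via u z′ x × dist w u < dist z′ u
  beyond {u} {x} {w} {p} {ch} {z′} wx up z′ch ch≢p = z′x , farther
    where
    u→z′ : dist u z′ ≡ dist w z′ + dist w u
    u→z′ = dist-across (dist w u) refl up z′ (λ z′p → ch≢p (≡-sym (via-unique z′p z′ch)))
    farther : dist w u < dist z′ u
    farther = subst (suc (dist w u) ≤_) (trans (≡-sym u→z′) (dist-sym u z′))
                    (+-monoˡ-≤ (dist w u) (subst (1 ≤_) (proj₂ z′ch) (s≤s z≤n)))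
    z′x : Via u z′ x
    z′x with Via? u z′ x
    ... | yes z′x = z′x
    ... | no z′∉x = ⊥-elim (via-≢ wx (≡-sym (dist≡0 (twice-absorbed (dist u w) (dist w z′) (begin
        dist u w + (dist u w + dist w z′)   ≡⟨ cong (dist u w +_) (+-comm (dist u w) (dist w z′)) ⟩
        dist u w + (dist w z′ + dist u w)   ≡⟨ cong (λ k → dist u w + (dist w z′ + k)) (dist-sym u w) ⟩
        dist u w + (dist w z′ + dist w u)   ≡⟨ cong (dist u w +_) u→z′ ⟨
        dist u w + dist u z′                ≡⟨ +-comm (dist u w) (dist u z′) ⟩
        dist u z′ + dist u w                ≡⟨ dist-across (dist u w) refl wx z′ z′∉x ⟨
        dist w z′                           ∎)))))
      where open ≡-Reasoning

  module _ {X : Subset n} (one-free : OneFreeLeg X) where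

    -- If
    -- it contained a major vertex, the one farthest from u would have two
    -- legs pointing away from u, both missing X.
    free-branch-is-free-leg : ∀ {u x} → Major G u → Adj G u x → Free (legLeaves X) u x → MajorFree u x × Free X u x
    free-branch-is-free-leg {u} {x} mu ex unmarked with MajorFree? u x
    ... | yes free with Free? X u x
    ...   | yes free-X = free , free-X
    ...   | no ¬free-X with leg-leaf-marked (mu , ex , free) ¬free-X
    ...     | ℓ , ℓx , marked = ⊥-elim (unmarked ℓ ℓx marked)
    free-branch-is-free-leg {u} {x} mu ex unmarked | no ¬free with any? (λ z → Via? u z x ×-dec Major? z)
    ... | no none = ⊥-elim (¬free (λ z zx mz → none (z , zx , mz)))
    ... | yes (z₀ , z₀x , mz₀) with argmax (λ z → Via u z x × Major G z) (λ z → Via? u z x ×-dec Major? z) (λ z → dist z u) z₀ (z₀x , mz₀)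
    ...   | w , (wx , mw) , deepest with via-exists {w} {u} (λ e → via-≢ wx (≡-sym e))
    ...     | p , up = ⊥-elim (two-away (major-neighbours mw))
      where
      away-free : ∀ {ch} → ch ≢ p → MajorFree w ch
      away-free ch≢p z′ z′ch mz′ = 1+n≰n (≤-trans (proj₂ (beyond wx up z′ch ch≢p)) (deepest z′ (proj₁ (beyond wx up z′ch ch≢p) , mz′)))
      away-free-X : ∀ {ch} → Adj G w ch → ch ≢ p → Free X w ch
      away-free-X {ch} ech ch≢p with Free? X w ch
      ... | yes free-X = free-X
      ... | no ¬free-X with leg-leaf-marked (mw , ech , away-free ch≢p) ¬free-X
      ...   | ℓ , ℓch , marked = ⊥-elim (unmarked ℓ (proj₁ (beyond wx up ℓch ch≢p)) marked)
      two-legs : ∀ {c₁ c₂} → Adj G w c₁ → Adj G w c₂ → c₁ ≢ c₂ → c₁ ≢ p → c₂ ≢ p → ⊥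
      two-legs e₁ e₂ c₁≢c₂ c₁≢p c₂≢p = one-free w _ _ (mw , e₁ , away-free c₁≢p) (mw , e₂ , away-free c₂≢p) c₁≢c₂
                                          (away-free-X e₁ c₁≢p) (away-free-X e₂ c₂≢p)
      two-away : (∃ λ a → ∃ λ b → ∃ λ c → Adj G w a × Adj G w b × Adj G w c × a ≢ b × a ≢ c × b ≢ c) → ⊥
      two-away (a , b , c , ea , eb , ec , a≢b , a≢c , b≢c) with a ≟ᶠ p | b ≟ᶠ p
      ... | yes refl | _ = two-legs eb ec b≢c (≢-sym a≢b) (≢-sym a≢c)
      ... | no a≢p | yes refl = two-legs ea ec a≢c a≢p (≢-sym b≢c)
      ... | no a≢p | no b≢p = two-legs ea eb a≢b a≢p b≢p

    legLeaves-one-free : OneFreeBranch (legLeaves X)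
    legLeaves-one-free u b c mu eb ec b≢c free-b free-c with free-branch-is-free-leg mu eb free-b | free-branch-is-free-leg mu ec free-c
    ... | mf-b , free-X-b | mf-c , free-X-c = one-free u b c (mu , eb , mf-b) (mu , ec , mf-c) b≢c free-X-b free-X-c

  dim≤ : ∀ {m X} → IsMetricDim G m → HasMajor → OneFreeLeg X → m ≤ ∣ X ∣
  dim≤ {m} {X} (_ , minimal) major one-free =
    ≤-trans (minimal (legLeaves X) (resolving (legLeaves-one-free one-free) major))
            (image-card LegLeaf LegLeaf? legLeaf-functional X)

  LegLeafOf : Fin n → Fin n → Set
  LegLeafOf v ℓ = ∃ λ c → Leg v c × Via v ℓ c × EndVertex G ℓ

  LegLeafOf? : ∀ v ℓ → Dec (LegLeafOf v ℓ)
  LegLeafOf? v ℓ = any? (λ c → Leg? v c ×-dec Via? v ℓ c ×-dec (deg G ℓ ≟ 1))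

  legLeaf⇒terminal : ∀ {v ℓ} → LegLeafOf v ℓ → Terminal G ℓ v
  legLeaf⇒terminal (c , (mv , _ , free) , ℓc , leaf) = leg-leaf-terminal mv free ℓc leaf

  terminal⇒legLeaf : ∀ {v ℓ} → Terminal G ℓ v → LegLeafOf v ℓ
  terminal⇒legLeaf {v} {ℓ} terminal@(mv , leaf , _) with via-exists {v} {ℓ} (λ { refl → leaf-not-major leaf mv })
  ... | c , ℓc = c , (mv , proj₁ ℓc , terminal-leg terminal ℓc) , ℓc , leaf

  terminals : Fin n → Subset n
  terminals v = subsetOf (LegLeafOf? v)

  ter-terminals : ∀ v → Ter G v ∣ terminals v ∣
  ter-terminals v = terminals v ,
    (λ ℓ → mk⇔ (λ m → legLeaf⇒terminal (∈-subsetOf⁻ (LegLeafOf? v) m)) (λ t → ∈-subsetOf⁺ (LegLeafOf? v) (terminal⇒legLeaf t))) ,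
    refl

  zero-forcing-one-free-leg : ∀ {S} → ZeroForcing G S → OneFreeLeg S
  zero-forcing-one-free-leg zf w c₁ c₂ (_ , e₁ , _) (_ , e₂ , _) = zero-forcing-meets-branch zf e₁ e₂

  module _ {S : Subset n} (zf : ZeroForcing G S) where

    remove-off-leg : ∀ y₀ → (∀ w c → Leg w c → ¬ Via w y₀ c) → OneFreeLeg (without S (_≟ᶠ y₀))
    remove-off-leg y₀ off-legs w c₁ c₂ leg₁ leg₂ c₁≢c₂ free₁ free₂ =
      zero-forcing-one-free-leg zf w c₁ c₂ leg₁ leg₂ c₁≢c₂ (still-free leg₁ free₁) (still-free leg₂ free₂)
      where
      still-free : ∀ {c} → Leg w c → Free (without S (_≟ᶠ y₀)) w c → Free S w c
      still-free leg free z zc z∈S with z ≟ᶠ y₀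
      ... | yes refl = off-legs w _ leg zc
      ... | no z≢y₀ = free z zc (∈-without⁺ (_≟ᶠ y₀) z∈S z≢y₀)

    leg-still-free : ∀ {v b₀ w c} → Leg v b₀ → Leg w c → (w ≡ v → c ≢ b₀) →
                     Free (without S (λ z → Via? v z b₀)) w c → Free S w c
    leg-still-free {v} {b₀} leg₀ leg other free z zc z∈S with Via? v z b₀
    ... | no z∉b₀ = free z zc (∈-without⁺ (λ z → Via? v z b₀) z∈S z∉b₀)
    ... | yes zb₀ with leg-owner-unique leg zc leg₀ zb₀
    ...   | refl = other refl (via-unique zc zb₀)

    remove-leg : ∀ {v b₀} → Leg v b₀ → (∀ c → Leg v c → c ≢ b₀ → ¬ Free S v c) →
                 OneFreeLeg (without S (λ z → Via? v z b₀))
    remove-leg {v} {b₀} leg₀ others-hit w c₁ c₂ leg₁ leg₂ c₁≢c₂ free₁ free₂ with w ≟ᶠ v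
    ... | no w≢v = zero-forcing-one-free-leg zf w c₁ c₂ leg₁ leg₂ c₁≢c₂
                     (leg-still-free leg₀ leg₁ (λ w≡v _ → w≢v w≡v) free₁) (leg-still-free leg₀ leg₂ (λ w≡v _ → w≢v w≡v) free₂)
    ... | yes refl with c₁ ≟ᶠ b₀
    ...   | yes refl = others-hit c₂ leg₂ c₂≢b₀ (leg-still-free leg₀ leg₂ (λ _ → c₂≢b₀) free₂)
      where
      c₂≢b₀ : c₂ ≢ c₁
      c₂≢b₀ e = c₁≢c₂ (≡-sym e)
    ...   | no c₁≢b₀ = others-hit c₁ leg₁ c₁≢b₀ (leg-still-free leg₀ leg₁ (λ _ → c₁≢b₀) free₁)

  module _ (no-major : ∀ u → ¬ Major G u) where

    -- Number the vertices by their distance from an end ℓ (a vertex with at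
    -- most one neighbour).
    module _ (ℓ : Fin n) (end : ∀ {a b} → Adj G ℓ a → Adj G ℓ b → a ≡ b) where

      end≢ : ∀ {z k} → dist z ℓ ≡ suc k → ℓ ≢ z
      end≢ {z} eq refl = 0≢1+n (trans (≡-sym (dist-refl z)) eq)

      -- Each distance from ℓ is attained at most once: two vertices at the same
      -- distance have the same step towards ℓ, which would then have degree 3.
      level-unique : ∀ k z z′ → dist z ℓ ≡ k → dist z′ ℓ ≡ k → z ≡ z′
      level-unique zero z z′ e e′ = trans (dist≡0 e) (≡-sym (dist≡0 e′))
      level-unique (suc k) z z′ e e′ with z ≟ᶠ z′
      ... | yes z≡z′ = z≡z′
      ... | no z≢z′ with via-exists (end≢ e) | via-exists (end≢ e′)
      ...   | q , zq | q′ , z′q′ with level-unique k q q′ (suc-injective (trans (proj₂ zq) e)) (suc-injective (trans (proj₂ z′q′) e′))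
      ...     | refl with q ≟ᶠ ℓ
      ...       | yes refl = ⊥-elim (z≢z′ (end (adj-sym (proj₁ zq)) (adj-sym (proj₁ z′q′))))
      ...       | no q≢ℓ with via-exists {q} {ℓ} (≢-sym q≢ℓ)
      ...         | r , qr with non-major-neighbours (no-major q) (adj-sym (proj₁ zq)) (adj-sym (proj₁ z′q′)) z≢z′ (proj₁ qr)
      ...           | inj₁ refl = ⊥-elim (via-antisym zq qr)
      ...           | inj₂ refl = ⊥-elim (via-antisym z′q′ qr)

      level-exists : ∀ k z → dist z ℓ ≡ k → ∀ j → j ≤ k → ∃ λ y → dist y ℓ ≡ j
      level-exists zero z e .zero z≤n = z , e
      level-exists (suc k) z e j j≤ with j ≟ suc k
      ... | yes refl = z , e
      ... | no j≢ with dist-step e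
      ...   | a , _ , da = level-exists k a da j (≤-pred (≤∧≢⇒< j≤ j≢))

      -- If e is a farthest vertex from ℓ, the vertex at distance i is the i-th
      -- vertex of a path through all of T.
      path-from-end : ∀ e → (∀ z → dist z ℓ ≤ dist e ℓ) → IsPathGraph G
      path-from-end e farthest = at , at-injective , adjacent⇔consecutive
        where
        all-levels : n ≤ suc (dist e ℓ)
        all-levels = ≮⇒≥ λ lt → collision (pigeonhole lt (λ z → fromℕ< (s≤s (farthest z))))
          where
          collision : ¬ (∃₂ λ i j → Data.Fin._<_ i j × fromℕ< (s≤s (farthest i)) ≡ fromℕ< (s≤s (farthest j)))
          collision (i , j , i<j , eq) = <⇒≢ᶠ i<j (level-unique (dist j ℓ) i j
            (trans (≡-sym (toℕ-fromℕ< (s≤s (farthest i)))) (trans (cong toℕ eq) (toℕ-fromℕ< (s≤s (farthest j))))) refl)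
        level : (i : Fin n) → ∃ λ y → dist y ℓ ≡ toℕ i
        level i = level-exists (dist e ℓ) e refl (toℕ i) (≤-pred (≤-trans (toℕ<n i) all-levels))
        at : Fin n → Fin n
        at i = proj₁ (level i)
        at-dist : ∀ i → dist (at i) ℓ ≡ toℕ i
        at-dist i = proj₂ (level i)
        at-injective : ∀ {i j} → at i ≡ at j → i ≡ j
        at-injective {i} {j} eq = toℕ-injective (trans (≡-sym (at-dist i)) (trans (cong (λ y → dist y ℓ) eq) (at-dist j)))
        step-down : ∀ i j → suc (toℕ i) ≡ toℕ j → Adj G (at j) (at i)
        step-down i j p with via-exists {at j} {ℓ} (end≢ (trans (at-dist j) (≡-sym p)))
        ... | q , jq with level-unique (toℕ i) q (at i) (suc-injective (trans (proj₂ jq) (trans (at-dist j) (≡-sym p)))) (at-dist i)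
        ...   | refl = proj₁ jq
        adjacent⇔consecutive : ∀ i j → Adj G (at i) (at j) ⇔ (suc (toℕ i) ≡ toℕ j ⊎ suc (toℕ j) ≡ toℕ i)
        adjacent⇔consecutive i j = mk⇔ to from
          where
          to : Adj G (at i) (at j) → suc (toℕ i) ≡ toℕ j ⊎ suc (toℕ j) ≡ toℕ i
          to a with adjacent-dist ℓ a
          ... | inj₁ p = inj₁ (trans (cong suc (≡-sym (at-dist i))) (trans (≡-sym p) (at-dist j)))
          ... | inj₂ p = inj₂ (trans (cong suc (≡-sym (at-dist j))) (trans (≡-sym p) (at-dist i)))
          from : suc (toℕ i) ≡ toℕ j ⊎ suc (toℕ j) ≡ toℕ i → Adj G (at i) (at j)
          from (inj₁ p) = adj-sym (step-down i j p)
          from (inj₂ p) = step-down j i p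

    -- A vertex farthest from any root is an end; a vertex farthest from it
    -- closes the path.
    no-major-path : IsPathGraph G
    no-major-path = from-size n refl
      where
      from-size : ∀ m → m ≡ n → IsPathGraph G
      from-size zero refl = (λ ()) , (λ {i} → λ _ → ⊥-elim (no-vertex i)) , λ ()
        where
        no-vertex : Fin 0 → ⊥
        no-vertex ()
      from-size (suc m) refl with argmax (λ _ → ⊤) (λ _ → yes tt) (λ z → dist z Fin.zero) Fin.zero tt
      ... | ℓ , _ , farthest-root with argmax (λ _ → ⊤) (λ _ → yes tt) (λ z → dist z ℓ) ℓ tt
      ...   | e , _ , farthest = path-from-end ℓ end e (λ z → farthest z tt)
        where
        towards-root : ∀ {a} → Adj G ℓ a → Via ℓ Fin.zero a
        towards-root {a} ea with adjacent-dist Fin.zero ea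
        ... | inj₂ p = ea , ≡-sym p
        ... | inj₁ p = ⊥-elim (1+n≰n (≤-trans (≤-reflexive (≡-sym p)) (farthest-root a tt)))
        end : ∀ {a b} → Adj G ℓ a → Adj G ℓ b → a ≡ b
        end ea eb = via-unique (towards-root ea) (towards-root eb)

  has-major : ¬ IsPathGraph G → HasMajor
  has-major not-path with any? Major?
  ... | yes major = major
  ... | no none = ⊥-elim (not-path (no-major-path (λ u mu → none (u , mu))))

  module MinimumZeroForcing {S S₀ : Subset n} {m : ℕ} (zf : ZeroForcing G S)
           (minimum : ∀ S′ → ZeroForcing G S′ → ∣ S ∣ ≤ ∣ S′ ∣)
           (dim : IsMetricDim G m) (zf₀ : ZeroForcing G S₀) (|S₀|≡m : ∣ S₀ ∣ ≡ m) where

    -- No set with at most one free leg at each major vertex is smaller than S,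
    -- since |S| = Z(T) = dim(T) ≤ |X|.
    S-minimal : ∀ {X} → HasMajor → OneFreeLeg X → ¬ (∣ X ∣ < ∣ S ∣)
    S-minimal {X} major one-free smaller = <-irrefl refl (begin-strict
      ∣ X ∣                     <⟨ smaller ⟩
      ∣ S ∣                     ≤⟨ minimum S₀ zf₀ ⟩
      ∣ S₀ ∣                    ≡⟨ |S₀|≡m ⟩
      m                         ≤⟨ dim≤ dim major one-free ⟩
      ∣ X ∣                     ∎)
      where open ≤-Reasoning

    -- A major vertex lies on no leg, so removing it from S would keep the property.
    major-∉S : ∀ {v} → Major G v → v ∉ S
    major-∉S {v} mv v∈S = S-minimal (v , mv) (remove-off-leg zf v (λ w c (_ , _ , free) vc → free v vc mv))
                                   (without-smaller (_≟ᶠ v) v∈S refl)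

    -- A vertex with a leg has a leg missing S: otherwise the vertices of S on
    -- one of its legs could be removed.
    free-leg-exists : ∀ {v b₀} → Leg v b₀ → ∃ λ c → Leg v c × Free S v c
    free-leg-exists {v} {b₀} leg₀ with any? (λ c → Leg? v c ×-dec Free? S v c)
    ... | yes found = found
    ... | no none with not-free (λ free₀ → none (b₀ , leg₀ , free₀))
    ...   | z , zb₀ , z∈S = ⊥-elim (S-minimal (v , proj₁ leg₀) (remove-leg zf leg₀ (λ c leg _ free → none (c , leg , free)))
                                              (without-smaller (λ z → Via? v z b₀) z∈S zb₀))

    -- Every vertex of S lies on a leg, otherwise it could be removed.
    on-leg : ∀ {x} → HasMajor → x ∈ S → ∃₂ λ v b → Leg v b × Via v x b
    on-leg {x} major x∈S with any? (λ v → any? (λ b → Leg? v b ×-dec Via? v x b))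
    ... | yes (v , b , found) = v , b , found
    ... | no none = ⊥-elim (S-minimal major (remove-off-leg zf x (λ w c leg xc → none (w , c , leg , xc)))
                                           (without-smaller (_≟ᶠ x) x∈S refl))

    -- A leg meeting S is not the only leg of its vertex, otherwise the
    -- vertices of S on it could be removed.
    second-leg : ∀ {x v b} → x ∈ S → Leg v b → Via v x b → ∃ λ c → Leg v c × c ≢ b
    second-leg {x} {v} {b} x∈S leg xb with any? (λ c → Leg? v c ×-dec ¬? (c ≟ᶠ b))
    ... | yes found = found
    ... | no none = ⊥-elim (S-minimal (v , proj₁ leg) (remove-leg zf leg (λ c leg′ c≢b _ → none (c , leg′ , c≢b)))
                                                      (without-smaller (λ z → Via? v z b) x∈S xb))

    unique-free-terminal : ∀ {v} → Major G v → (∃ λ ℓ₀ → Terminal G ℓ₀ v) →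
      ∃ λ ℓ → Terminal G ℓ v × (∀ p → IsPath G v ℓ p → All (_∉ S) p)
            × (∀ ℓ′ → Terminal G ℓ′ v → (∀ p → IsPath G v ℓ′ p → All (_∉ S) p) → ℓ′ ≡ ℓ)
    unique-free-terminal {v} mv (_ , terminal₀) with free-leg-exists (proj₁ (proj₂ (terminal⇒legLeaf terminal₀)))
    ... | c , (_ , ec , mfc) , free with branch-leaf ec
    ...   | ℓ , ℓc , leaf = ℓ , leg-leaf-terminal mv mfc ℓc leaf , path-avoids ℓc free (major-∉S mv) , unique
      where
      unique : ∀ ℓ′ → Terminal G ℓ′ v → (∀ p → IsPath G v ℓ′ p → All (_∉ S) p) → ℓ′ ≡ ℓ
      unique ℓ′ terminal′ avoids′ with terminal⇒legLeaf terminal′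
      ... | c′ , (_ , ec′ , mfc′) , ℓ′c′ , leaf′ with c′ ≟ᶠ c
      ...   | yes refl = leg-leaf-unique mfc ℓc leaf ℓ′c′ leaf′
      ...   | no c′≢c = ⊥-elim (zero-forcing-meets-branch zf ec′ ec c′≢c (leg-free-if-path-avoids mfc′ ℓ′c′ leaf′ avoids′) free)

    on-terminal-path : ∀ {x} → HasMajor → x ∈ S → ∃ λ v → ∃ λ ℓ → ∃ λ k → ∃ λ p →
      Ter G v k × 2 ≤ k × Terminal G ℓ v × IsPath G v ℓ p × x ∈ₗ p × x ≢ v
    on-terminal-path {x} major x∈S with on-leg major x∈S
    ... | v , b , leg@(mv , eb , mfb) , xb with second-leg x∈S leg xb | branch-leaf eb
    ...   | c , legc@(_ , ec , _) , c≢b | ℓ , ℓb , leaf with branch-leaf ec | leg-path mfb ℓb leaf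
    ...     | ℓ′ , ℓ′c , leaf′ | p , path , covers =
          v , ℓ , ∣ terminals v ∣ , p , ter-terminals v , two-terminals , leg-leaf-terminal mv mfb ℓb leaf , path ,
          covers x xb , via-≢ xb
      where
      two-terminals : 2 ≤ ∣ terminals v ∣
      two-terminals = two-in (terminals v) (∈-subsetOf⁺ (LegLeafOf? v) (b , leg , ℓb , leaf))
                        (∈-subsetOf⁺ (LegLeafOf? v) (c , legc , ℓ′c , leaf′))
                        (λ ℓ≡ℓ′ → c≢b (via-unique (subst (λ y → Via v y c) (≡-sym ℓ≡ℓ′) ℓ′c) ℓb))

terminal-exists : ∀ {n} {G : Graph n} {v k} → Ter G v k → 1 ≤ k → ∃ λ ℓ → Terminal G ℓ v
terminal-exists (T , T⇔terminal , |T|≡k) 1≤k with nonempty T (subst (1 ≤_) (≡-sym |T|≡k) 1≤k)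
... | ℓ , ℓ∈T = ℓ , Equivalence.to (T⇔terminal ℓ) ℓ∈T

lemma2p11 : ∀ {n} (G : Graph n) → IsTree G → ¬ IsPathGraph G →
  (∃ λ m → IsMetricDim G m × IsZeroForcingNumber G m) →
  ∀ S → MinZeroForcing G S →
  (∀ v k → Major G v → Ter G v k → 1 ≤ k →
    ∃ λ ℓ → Terminal G ℓ v
      × (∀ p → IsPath G v ℓ p → All (λ x → x ∉ S) p)
      × (∀ ℓ′ → Terminal G ℓ′ v → (∀ p → IsPath G v ℓ′ p → All (λ x → x ∉ S) p) → ℓ′ ≡ ℓ))
  × (∀ x → x ∈ S → ∃ λ v → ∃ λ ℓ → ∃ λ k → ∃ λ p →
      Ter G v k × 2 ≤ k × Terminal G ℓ v × IsPath G v ℓ p × x ∈ₗ p × x ≢ v)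
lemma2p11 G (conn , acyclic) not-path (m , dim , (S₀ , zf₀ , |S₀|≡m) , _) S (zf , minimum) =
  (λ v k mv ter 1≤k → unique-free-terminal mv (terminal-exists ter 1≤k)) ,
  (λ x x∈S → on-terminal-path (has-major not-path) x∈S)
  where
  open Tree G conn acyclic
  open MinimumZeroForcing zf minimum dim zf₀ |S₀|≡m
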